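{- For every real $0\le\mu\le1$, $\mathbf{I}[\ell\langle\mu\rangle]\le 4/3$.
   Context: $\mathrm{true}=-1$, $\mathrm{false}=+1$, $N=2^n$. For $x\in\{ -1,1\}^n$ let $\mathrm{val}(x)=\sum_{i=1}^n b_i2^{n-i}$ with $b_i=0$ if $x_i=\mathrm{true}$, $b_i=1$ if $x_i=\mathrm{false}$. For an integer $0\le s\le N$, $\ell_n\langle s\rangle$ is the Boolean function on $n$ variables that is $\mathrm{true}$ exactly when $\mathrm{val}(x)<s$; for real $0\le\mu\le1$, $\ell_n\langle\mu\rangle=\ell_n\langle\lfloor\mu N\rfloor\rangle$. The total influence is $\mathbf{I}[f]=\sum_S\hat f(S)^2|S|$ with $\hat f(S)=\mathbf{E}_x[f(x)\prod_{i\in S}x_i]$, $x$ uniform. $\mathbf{I}[\ell\langle\mu\rangle]$ denotes $\lim_{n\to\infty}\mathbf{I}[\ell_n\langle\mu\rangle]$. -}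

module Defs where

open import Data.Bool using (Bool; true; false; if_then_else_)
open import Data.Nat as ℕ using (ℕ; zero; suc; _^_; _<ᵇ_; _≤_)
open import Data.Nat.Properties using (m^n≢0)
open import Data.Integer as ℤ using (ℤ; +_)
open import Data.Rational as ℚ using (ℚ; _/_)
open import Data.Vec using (Vec; []; _∷_)
open import Data.List using (List; []; _∷_; map; _++_; foldr)
open import Data.Product using (∃)
open import Relation.Binary.PropositionalEquality using (_≡_)
open import Relation.Nullary using (¬_)

-- Points of {-1,1}^n: a vector of truth values; the Boolean value `true`
-- encodes the real number -1 (= true) and `false` encodes +1 (= false).
Cube : ℕ → Set
Cube n = Vec Bool n

-- all 2^n points of the cube (also used for all subsets S ⊆ [n],
-- a subset being its indicator vector)
allCube : (n : ℕ) → List (Cube n)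
allCube zero = [] ∷ []
allCube (suc n) = map (true ∷_) (allCube n) ++ map (false ∷_) (allCube n)

sign : Bool → ℤ
sign true = ℤ.-[1+ 0 ]
sign false = + 1

bit : Bool → ℕ
bit true = 0
bit false = 1

val : {n : ℕ} → Cube n → ℕ
val [] = 0
val {suc n} (x ∷ xs) = bit x ℕ.* 2 ^ n ℕ.+ val xs

ℓ : (n s : ℕ) → Cube n → ℤ
ℓ n s x = if val x <ᵇ s then ℤ.-[1+ 0 ] else + 1

χ : {n : ℕ} → Vec Bool n → Cube n → ℤ
χ [] [] = + 1
χ (s ∷ S) (x ∷ xs) = (if s then sign x else + 1) ℤ.* χ S xs

card : {n : ℕ} → Vec Bool n → ℕ
card [] = 0
card (true ∷ S) = suc (card S)
card (false ∷ S) = card S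

sumℤ : List ℤ → ℤ
sumℤ = foldr ℤ._+_ (+ 0)

sumℚ : List ℚ → ℚ
sumℚ = foldr ℚ._+_ ℚ.0ℚ

fourier : (n : ℕ) → (Cube n → ℤ) → Vec Bool n → ℚ
fourier n f S =
  _/_ (sumℤ (map (λ x → f x ℤ.* χ S x) (allCube n))) (2 ^ n) {{m^n≢0 2 n}}

influence : (n : ℕ) → (Cube n → ℤ) → ℚ
influence n f =
  sumℚ (map (λ S → fourier n f S ℚ.* fourier n f S ℚ.* ((+ card S) / 1)) (allCube n))

-- A real in [0,1) is given by its canonical binary
-- expansion μ = Σ_k d_k 2^-(k+1) (d k = true meaning digit 1), canonical
-- meaning not eventually all 1's; μ = 1 is a separate constructor.
EventuallyOne : (ℕ → Bool) → Set
EventuallyOne d = ∃ λ M → (k : ℕ) → M ≤ k → d k ≡ true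

data UnitReal : Set where
  one    : UnitReal
  digits : (d : ℕ → Bool) → ¬ EventuallyOne d → UnitReal

digit : Bool → ℕ
digit true = 1
digit false = 0

-- floor(μ · 2^n)
floorScaled : UnitReal → ℕ → ℕ
floorScaled one n = 2 ^ n
floorScaled (digits d _) zero = 0
floorScaled (digits d c) (suc n) = 2 ℕ.* floorScaled (digits d c) n ℕ.+ digit (d n)

ℓμ : UnitReal → (n : ℕ) → Cube n → ℤ
ℓμ μ n = ℓ n (floorScaled μ n)

-- Write A = 2ⁿ f̂ and Q(f) = 4ⁿ I[f] = Σ_S A(S)² |S|, both integers. Splitting on the first
-- coordinate into restrictions g, h gives Q(f) = 2 Q(g) + 2 Q(h) + 2ⁿ Σₓ (h − g)², by Parseval.
-- For ℓ_{n+1}⟨s⟩ one restriction is constant and the other is ℓ_n⟨s⟩ or ℓ_n⟨s − N⟩ (N = 2ⁿ),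
-- so q(n, s) = Q(ℓ_n⟨s⟩) satisfies q(n+1, s) = 2 q(n, s) + 4Ns if s ≤ N, and
-- q(n+1, N + s') = 2 q(n, s') + 4N(N − s').
-- A single step does not preserve 3 q ≤ 4 N², but two steps give q(n+2, s) = 4 q(n, r) + 16 N t
-- with t ≤ N, which does. So I[ℓ_n⟨s⟩] ≤ 4/3 holds for every n, not only in the limit.

module Submission where

open import Defs
open import Data.Bool using (Bool; true; false; if_then_else_)
open import Data.Unit using (tt)
open import Data.Nat as ℕ using (ℕ; zero; suc; _^_; _<ᵇ_; _≥_; z≤n; s≤s)
import Data.Nat.Properties as ℕ
open import Data.Integer as ℤ using (ℤ; +_; -[1+_]; _+_; _*_; -_; _-_; +≤+)
import Data.Integer.Properties as ℤ
open import Data.Integer.Tactic.RingSolver using (solve-∀)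
open import Data.Rational as ℚ using (ℚ; _/_; toℚᵘ; Positive)
import Data.Rational.Properties as ℚ
open import Data.Rational.Unnormalised as ℚᵘ using (mkℚᵘ; *≡*; *≤*)
import Data.Rational.Unnormalised.Properties as ℚᵘ
open import Data.List using (List; []; _∷_; map; _++_)
open import Data.List.Properties using (map-∘)
open import Data.Vec using (Vec; []; _∷_)
open import Data.Product using (∃; ∃₂; _×_; _,_)
open import Relation.Binary.PropositionalEquality
open import Relation.Nullary using (yes; no; contradiction)
open import Relation.Nullary.Decidable using (toWitness)

module _ {X : Set} where

  sum-cong : ∀ (xs : List X) {F G : X → ℤ} → (∀ x → F x ≡ G x) →
             sumℤ (map F xs) ≡ sumℤ (map G xs)
  sum-cong []       F≗G = refl
  sum-cong (x ∷ xs) F≗G = cong₂ _+_ (F≗G x) (sum-cong xs F≗G)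

  sum-+ : ∀ (xs : List X) (F G : X → ℤ) →
          sumℤ (map (λ x → F x + G x) xs) ≡ sumℤ (map F xs) + sumℤ (map G xs)
  sum-+ []       F G = refl
  sum-+ (x ∷ xs) F G rewrite sum-+ xs F G = interchange (F x) (G x) _ _
    where
    interchange : ∀ a b c d → a + b + (c + d) ≡ a + c + (b + d)
    interchange = solve-∀

  sum-*ˡ : ∀ (xs : List X) (c : ℤ) (F : X → ℤ) →
           sumℤ (map (λ x → c * F x) xs) ≡ c * sumℤ (map F xs)
  sum-*ˡ []       c F = sym (ℤ.*-zeroʳ c)
  sum-*ˡ (x ∷ xs) c F rewrite sum-*ˡ xs c F = sym (ℤ.*-distribˡ-+ c (F x) _)

  sum-++ : ∀ (xs ys : List X) (F : X → ℤ) →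
           sumℤ (map F (xs ++ ys)) ≡ sumℤ (map F xs) + sumℤ (map F ys)
  sum-++ []       ys F = sym (ℤ.+-identityˡ _)
  sum-++ (x ∷ xs) ys F rewrite sum-++ xs ys F = sym (ℤ.+-assoc (F x) _ _)

sumCube : (n : ℕ) → (Cube n → ℤ) → ℤ
sumCube n F = sumℤ (map F (allCube n))

restrict : Bool → {n : ℕ} → (Cube (suc n) → ℤ) → Cube n → ℤ
restrict b f y = f (b ∷ y)

sumCube-suc : ∀ n (F : Cube (suc n) → ℤ) →
              sumCube (suc n) F ≡ sumCube n (restrict true F) + sumCube n (restrict false F)
sumCube-suc n F = trans (sum-++ (map (true ∷_) (allCube n)) _ F)
  (sym (cong₂ _+_ (cong sumℤ (map-∘ (allCube n))) (cong sumℤ (map-∘ (allCube n)))))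

sumCube-cong : ∀ n {F G : Cube n → ℤ} → (∀ x → F x ≡ G x) → sumCube n F ≡ sumCube n G
sumCube-cong n = sum-cong (allCube n)

sumCube-+ : ∀ n (F G : Cube n → ℤ) → sumCube n (λ x → F x + G x) ≡ sumCube n F + sumCube n G
sumCube-+ n = sum-+ (allCube n)

sumCube-*ˡ : ∀ n c (F : Cube n → ℤ) → sumCube n (λ x → c * F x) ≡ c * sumCube n F
sumCube-*ˡ n = sum-*ˡ (allCube n)

sumCube-const : ∀ n c → sumCube n (λ _ → c) ≡ + (2 ^ n) * c
sumCube-const zero    c = trans (ℤ.+-identityʳ c) (sym (ℤ.*-identityˡ c))
sumCube-const (suc n) c = begin
  sumCube (suc n) (λ _ → c)               ≡⟨ sumCube-suc n (λ _ → c) ⟩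
  sumCube n (λ _ → c) + sumCube n (λ _ → c) ≡⟨ cong₂ _+_ (sumCube-const n c) (sumCube-const n c) ⟩
  + (2 ^ n) * c + + (2 ^ n) * c           ≡⟨ double (+ (2 ^ n)) c ⟩
  (+ 2 * + (2 ^ n)) * c                   ≡⟨ cong (_* c) (sym (ℤ.pos-* 2 (2 ^ n))) ⟩
  + (2 ^ suc n) * c                       ∎
  where
  open ≡-Reasoning
  double : ∀ a c → a * c + a * c ≡ (+ 2 * a) * c
  double = solve-∀

sumCube-linear : ∀ n a b (F G : Cube n → ℤ) →
                 sumCube n (λ x → a * F x + b * G x) ≡ a * sumCube n F + b * sumCube n G
sumCube-linear n a b F G =
  trans (sumCube-+ n _ _) (cong₂ _+_ (sumCube-*ˡ n a F) (sumCube-*ˡ n b G))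

-- `fourier n f S` is definitionally `scaledFourier n f S / 2 ^ n`.
scaledFourier : (n : ℕ) → (Cube n → ℤ) → Vec Bool n → ℤ
scaledFourier n f S = sumCube n (λ x → f x * χ S x)

scaledFourier-cong : ∀ n {f g : Cube n → ℤ} → (∀ x → f x ≡ g x) →
                     ∀ S → scaledFourier n f S ≡ scaledFourier n g S
scaledFourier-cong n f≗g S = sumCube-cong n (λ x → cong (_* χ S x) (f≗g x))

scaledFourier-true∷ : ∀ n (f : Cube (suc n) → ℤ) S →
  scaledFourier (suc n) f (true ∷ S) ≡
  scaledFourier n (restrict false f) S - scaledFourier n (restrict true f) S
scaledFourier-true∷ n f S = begin
  scaledFourier (suc n) f (true ∷ S)
    ≡⟨ sumCube-suc n _ ⟩
  sumCube n (λ y → g y * (-[1+ 0 ] * χ S y)) + sumCube n (λ y → h y * (+ 1 * χ S y))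
    ≡⟨ cong₂ _+_ (sumCube-cong n (λ y → pull (g y) (χ S y)))
                 (sumCube-cong n (λ y → cong (h y *_) (ℤ.*-identityˡ (χ S y)))) ⟩
  sumCube n (λ y → -[1+ 0 ] * (g y * χ S y)) + scaledFourier n h S
    ≡⟨ cong (_+ scaledFourier n h S) (trans (sumCube-*ˡ n -[1+ 0 ] _) (ℤ.-1*i≡-i _)) ⟩
  - scaledFourier n g S + scaledFourier n h S
    ≡⟨ ℤ.+-comm (- scaledFourier n g S) (scaledFourier n h S) ⟩
  scaledFourier n h S - scaledFourier n g S ∎
  where
  open ≡-Reasoning
  g = restrict true f
  h = restrict false f
  pull : ∀ a b → a * (-[1+ 0 ] * b) ≡ -[1+ 0 ] * (a * b)
  pull = solve-∀

scaledFourier-false∷ : ∀ n (f : Cube (suc n) → ℤ) S →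
  scaledFourier (suc n) f (false ∷ S) ≡
  scaledFourier n (restrict true f) S + scaledFourier n (restrict false f) S
scaledFourier-false∷ n f S = trans (sumCube-suc n _) (cong₂ _+_
  (sumCube-cong n (λ y → cong (f (true ∷ y) *_) (ℤ.*-identityˡ (χ S y))))
  (sumCube-cong n (λ y → cong (f (false ∷ y) *_) (ℤ.*-identityˡ (χ S y)))))

scaledFourier-difference : ∀ n (g h : Cube n → ℤ) S →
  scaledFourier n (λ y → h y - g y) S ≡ scaledFourier n h S - scaledFourier n g S
scaledFourier-difference n g h S = begin
  scaledFourier n (λ y → h y - g y) S
    ≡⟨ sumCube-cong n (λ y → distrib (h y) (g y) (χ S y)) ⟩
  sumCube n (λ y → + 1 * (h y * χ S y) + -[1+ 0 ] * (g y * χ S y))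
    ≡⟨ sumCube-linear n (+ 1) -[1+ 0 ] _ _ ⟩
  + 1 * scaledFourier n h S + -[1+ 0 ] * scaledFourier n g S
    ≡⟨ cong₂ _+_ (ℤ.*-identityˡ (scaledFourier n h S)) (ℤ.-1*i≡-i (scaledFourier n g S)) ⟩
  scaledFourier n h S - scaledFourier n g S ∎
  where
  open ≡-Reasoning
  distrib : ∀ a b c → (a - b) * c ≡ + 1 * (a * c) + -[1+ 0 ] * (b * c)
  distrib = solve-∀

-- fourierWeight n f = 2 ^ n · Σₓ f(x)² by Parseval, and scaledInfluence n f = 4 ^ n · I[f].
fourierWeight : (n : ℕ) → (Cube n → ℤ) → ℤ
fourierWeight n f = sumCube n (λ S → scaledFourier n f S * scaledFourier n f S)

scaledInfluence : (n : ℕ) → (Cube n → ℤ) → ℤ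
scaledInfluence n f =
  sumCube n (λ S → scaledFourier n f S * scaledFourier n f S * + card S)

fourierWeight-cong : ∀ n {f g : Cube n → ℤ} → (∀ x → f x ≡ g x) →
                     fourierWeight n f ≡ fourierWeight n g
fourierWeight-cong n f≗g =
  sumCube-cong n (λ S → cong₂ _*_ (scaledFourier-cong n f≗g S) (scaledFourier-cong n f≗g S))

scaledInfluence-cong : ∀ n {f g : Cube n → ℤ} → (∀ x → f x ≡ g x) →
                       scaledInfluence n f ≡ scaledInfluence n g
scaledInfluence-cong n f≗g = sumCube-cong n (λ S → cong (_* + card S)
  (cong₂ _*_ (scaledFourier-cong n f≗g S) (scaledFourier-cong n f≗g S)))

fourierWeight-suc : ∀ n (f : Cube (suc n) → ℤ) →
  fourierWeight (suc n) f ≡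
  + 2 * fourierWeight n (restrict true f) + + 2 * fourierWeight n (restrict false f)
fourierWeight-suc n f = begin
  fourierWeight (suc n) f
    ≡⟨ sumCube-suc n _ ⟩
  sumCube n (λ S → a (true ∷ S) * a (true ∷ S)) + sumCube n (λ S → a (false ∷ S) * a (false ∷ S))
    ≡⟨ sym (sumCube-+ n _ _) ⟩
  sumCube n (λ S → a (true ∷ S) * a (true ∷ S) + a (false ∷ S) * a (false ∷ S))
    ≡⟨ sumCube-cong n pointwise ⟩
  sumCube n (λ S → + 2 * (ag S * ag S) + + 2 * (ah S * ah S))
    ≡⟨ sumCube-linear n (+ 2) (+ 2) _ _ ⟩
  + 2 * fourierWeight n g + + 2 * fourierWeight n h ∎
  where
  open ≡-Reasoning
  a = scaledFourier (suc n) f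
  g = restrict true f
  h = restrict false f
  ag = scaledFourier n g
  ah = scaledFourier n h
  identity : ∀ a b → (b - a) * (b - a) + (a + b) * (a + b) ≡ + 2 * (a * a) + + 2 * (b * b)
  identity = solve-∀
  pointwise : ∀ S → a (true ∷ S) * a (true ∷ S) + a (false ∷ S) * a (false ∷ S)
                  ≡ + 2 * (ag S * ag S) + + 2 * (ah S * ah S)
  pointwise S rewrite scaledFourier-true∷ n f S | scaledFourier-false∷ n f S =
    identity (ag S) (ah S)

parseval : ∀ n (f : Cube n → ℤ) → fourierWeight n f ≡ + (2 ^ n) * sumCube n (λ x → f x * f x)
parseval zero f = base (f [])
  where
  base : ∀ a → (a * + 1 + + 0) * (a * + 1 + + 0) + + 0 ≡ + 1 * (a * a + + 0)
  base = solve-∀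
parseval (suc n) f = begin
  fourierWeight (suc n) f
    ≡⟨ fourierWeight-suc n f ⟩
  + 2 * fourierWeight n g + + 2 * fourierWeight n h
    ≡⟨ cong₂ (λ u v → + 2 * u + + 2 * v) (parseval n g) (parseval n h) ⟩
  + 2 * (+ (2 ^ n) * sumCube n (λ x → g x * g x)) + + 2 * (+ (2 ^ n) * sumCube n (λ x → h x * h x))
    ≡⟨ collect (+ (2 ^ n)) _ _ ⟩
  (+ 2 * + (2 ^ n)) * (sumCube n (λ x → g x * g x) + sumCube n (λ x → h x * h x))
    ≡⟨ cong₂ _*_ (sym (ℤ.pos-* 2 (2 ^ n))) (sym (sumCube-suc n (λ x → f x * f x))) ⟩
  + (2 ^ suc n) * sumCube (suc n) (λ x → f x * f x) ∎
  where
  open ≡-Reasoning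
  g = restrict true f
  h = restrict false f
  collect : ∀ N u v → + 2 * (N * u) + + 2 * (N * v) ≡ (+ 2 * N) * (u + v)
  collect = solve-∀

-- Coordinates S ∋ 1 gain one unit of |S|; their extra weight is the Fourier weight of the
-- difference of the two restrictions.
scaledInfluence-suc : ∀ n (f : Cube (suc n) → ℤ) →
  scaledInfluence (suc n) f ≡
  + 2 * scaledInfluence n (restrict true f) + + 2 * scaledInfluence n (restrict false f)
  + fourierWeight n (λ y → restrict false f y - restrict true f y)
scaledInfluence-suc n f = begin
  scaledInfluence (suc n) f
    ≡⟨ sumCube-suc n _ ⟩
  sumCube n (λ S → a (true ∷ S) * a (true ∷ S) * + suc (card S))
    + sumCube n (λ S → a (false ∷ S) * a (false ∷ S) * + card S)
    ≡⟨ sym (sumCube-+ n _ _) ⟩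
  sumCube n (λ S → a (true ∷ S) * a (true ∷ S) * + suc (card S)
                   + a (false ∷ S) * a (false ∷ S) * + card S)
    ≡⟨ sumCube-cong n pointwise ⟩
  sumCube n (λ S → (+ 2 * (ag S * ag S * + card S) + + 2 * (ah S * ah S * + card S)) + d S * d S)
    ≡⟨ sumCube-+ n _ _ ⟩
  sumCube n (λ S → + 2 * (ag S * ag S * + card S) + + 2 * (ah S * ah S * + card S))
    + fourierWeight n (λ y → h y - g y)
    ≡⟨ cong (_+ fourierWeight n (λ y → h y - g y)) (sumCube-linear n (+ 2) (+ 2) _ _) ⟩
  + 2 * scaledInfluence n g + + 2 * scaledInfluence n h + fourierWeight n (λ y → h y - g y) ∎
  where
  open ≡-Reasoning
  a = scaledFourier (suc n) f
  g = restrict true f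
  h = restrict false f
  ag = scaledFourier n g
  ah = scaledFourier n h
  d = scaledFourier n (λ y → h y - g y)
  identity : ∀ a b c → (b - a) * (b - a) * (+ 1 + c) + (a + b) * (a + b) * c
                       ≡ (+ 2 * (a * a * c) + + 2 * (b * b * c)) + (b - a) * (b - a)
  identity = solve-∀
  pointwise : ∀ S → a (true ∷ S) * a (true ∷ S) * + suc (card S) + a (false ∷ S) * a (false ∷ S) * + card S
                  ≡ (+ 2 * (ag S * ag S * + card S) + + 2 * (ah S * ah S * + card S)) + d S * d S
  pointwise S rewrite scaledFourier-true∷ n f S | scaledFourier-false∷ n f S
                    | scaledFourier-difference n g h S = identity (ag S) (ah S) (+ card S)

scaledInfluence-dim0 : ∀ (f : Cube 0 → ℤ) → scaledInfluence 0 f ≡ + 0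
scaledInfluence-dim0 f = vanish (scaledFourier 0 f [])
  where
  vanish : ∀ a → a * a * + 0 + + 0 ≡ + 0
  vanish = solve-∀

scaledInfluence-const : ∀ n c → scaledInfluence n (λ _ → c) ≡ + 0
scaledInfluence-const zero    c = scaledInfluence-dim0 (λ _ → c)
scaledInfluence-const (suc n) c = begin
  scaledInfluence (suc n) (λ _ → c)
    ≡⟨ scaledInfluence-suc n (λ _ → c) ⟩
  + 2 * scaledInfluence n (λ _ → c) + + 2 * scaledInfluence n (λ _ → c) + fourierWeight n (λ _ → c - c)
    ≡⟨ cong₂ (λ u v → + 2 * u + + 2 * u + v) (scaledInfluence-const n c) (parseval n (λ _ → c - c)) ⟩
  + 0 + + (2 ^ n) * sumCube n (λ _ → (c - c) * (c - c))
    ≡⟨ cong (λ u → + 0 + + (2 ^ n) * u) (trans (sumCube-cong n (λ _ → cancel c)) (sumCube-const n (+ 0))) ⟩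
  + 0 + + (2 ^ n) * (+ (2 ^ n) * + 0)
    ≡⟨ vanish (+ (2 ^ n)) ⟩
  + 0 ∎
  where
  open ≡-Reasoning
  cancel : ∀ c → (c - c) * (c - c) ≡ + 0
  cancel = solve-∀
  vanish : ∀ N → + 0 + N * (N * + 0) ≡ + 0
  vanish = solve-∀

val<2^n : ∀ {n} (x : Cube n) → val x ℕ.< 2 ^ n
val<2^n []                  = s≤s z≤n
val<2^n {suc n} (true ∷ x)  = ℕ.<-≤-trans (val<2^n x) (ℕ.m≤m+n (2 ^ n) _)
val<2^n {suc n} (false ∷ x) = subst (λ z → z ℕ.+ val x ℕ.< 2 ^ n ℕ.+ z)
  (sym (ℕ.+-identityʳ (2 ^ n))) (ℕ.+-monoʳ-< (2 ^ n) (val<2^n x))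

ℓ-below : ∀ {n s} (x : Cube n) → val x ℕ.< s → ℓ n s x ≡ -[1+ 0 ]
ℓ-below {n} {s} x x<s with val x <ᵇ s | ℕ.<⇒<ᵇ x<s
... | true | _ = refl

ℓ-above : ∀ {n s} (x : Cube n) → s ℕ.≤ val x → ℓ n s x ≡ + 1
ℓ-above {n} {s} x s≤x with val x <ᵇ s | ℕ.<ᵇ⇒< (val x) s
... | false | _    = refl
... | true  | x<s = contradiction (x<s tt) (ℕ.≤⇒≯ s≤x)

ℓ²≡1 : ∀ n s x → ℓ n s x * ℓ n s x ≡ + 1
ℓ²≡1 n s x with val x <ᵇ s
... | true  = refl
... | false = refl

<ᵇ-cancelˡ : ∀ k m n → (k ℕ.+ m <ᵇ k ℕ.+ n) ≡ (m <ᵇ n)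
<ᵇ-cancelˡ zero    m n = refl
<ᵇ-cancelˡ (suc k) m n = <ᵇ-cancelˡ k m n

-- On the half x₁ = true, `ℓ (suc n) s` is `ℓ n s` by definition.
ℓ-false∷-lower : ∀ {n s} → s ℕ.≤ 2 ^ n → ∀ y → ℓ (suc n) s (false ∷ y) ≡ + 1
ℓ-false∷-lower {n} p y = ℓ-above (false ∷ y)
  (ℕ.≤-trans p (ℕ.≤-trans (ℕ.m≤m+n (2 ^ n) 0) (ℕ.m≤m+n (2 ^ n ℕ.+ 0) (val y))))

ℓ-true∷-upper : ∀ {n} s y → ℓ (suc n) (2 ^ n ℕ.+ s) (true ∷ y) ≡ -[1+ 0 ]
ℓ-true∷-upper {n} s y = ℓ-below (true ∷ y) (ℕ.<-≤-trans (val<2^n y) (ℕ.m≤m+n (2 ^ n) s))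

ℓ-false∷-upper : ∀ {n} s y → ℓ (suc n) (2 ^ n ℕ.+ s) (false ∷ y) ≡ ℓ n s y
ℓ-false∷-upper {n} s y = cong (λ b → if b then -[1+ 0 ] else + 1)
  (trans (cong (λ z → z ℕ.+ val y <ᵇ 2 ^ n ℕ.+ s) (ℕ.+-identityʳ (2 ^ n)))
         (<ᵇ-cancelˡ (2 ^ n) (val y) s))

data Half (n : ℕ) : ℕ → Set where
  lower : ∀ {s} → s ℕ.≤ 2 ^ n → Half n s
  upper : ∀ {s} → s ℕ.≤ 2 ^ n → Half n (2 ^ n ℕ.+ s)

half : ∀ n {s} → s ℕ.≤ 2 ^ suc n → Half n s
half n {s} s≤2N with s ℕ.≤? 2 ^ n
... | yes s≤N = lower s≤N
... | no  s≰N = subst (Half n) (ℕ.m+[n∸m]≡n N≤s) (upper rest≤N)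
  where
  N≤s = ℕ.<⇒≤ (ℕ.≰⇒> s≰N)
  rest≤N : s ℕ.∸ 2 ^ n ℕ.≤ 2 ^ n
  rest≤N = ℕ.≤-trans (ℕ.∸-monoˡ-≤ (2 ^ n) s≤2N) (ℕ.≤-reflexive
    (trans (cong (λ z → 2 ^ n ℕ.+ z ℕ.∸ 2 ^ n) (ℕ.+-identityʳ (2 ^ n))) (ℕ.m+n∸m≡n (2 ^ n) (2 ^ n))))

sum-ℓ : ∀ n s → s ℕ.≤ 2 ^ n → sumCube n (ℓ n s) ≡ + (2 ^ n) - + 2 * + s
sum-ℓ zero zero             _ = refl
sum-ℓ zero (suc zero)       _ = refl
sum-ℓ zero (suc (suc s)) (s≤s ())
sum-ℓ (suc n) s p with half n p
... | lower s≤N = begin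
  sumCube (suc n) (ℓ (suc n) s)
    ≡⟨ sumCube-suc n _ ⟩
  sumCube n (ℓ n s) + sumCube n (restrict false (ℓ (suc n) s))
    ≡⟨ cong₂ _+_ (sum-ℓ n s s≤N) (trans (sumCube-cong n (ℓ-false∷-lower s≤N)) (sumCube-const n (+ 1))) ⟩
  (+ (2 ^ n) - + 2 * + s) + + (2 ^ n) * + 1
    ≡⟨ identity (+ (2 ^ n)) (+ s) ⟩
  + 2 * + (2 ^ n) - + 2 * + s
    ≡⟨ cong (_- + 2 * + s) (sym (ℤ.pos-* 2 (2 ^ n))) ⟩
  + (2 ^ suc n) - + 2 * + s ∎
  where
  open ≡-Reasoning
  identity : ∀ N s → (N - + 2 * s) + N * + 1 ≡ + 2 * N - + 2 * s
  identity = solve-∀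
... | upper {s'} s'≤N = begin
  sumCube (suc n) (ℓ (suc n) (2 ^ n ℕ.+ s'))
    ≡⟨ sumCube-suc n _ ⟩
  sumCube n (restrict true (ℓ (suc n) (2 ^ n ℕ.+ s')))
    + sumCube n (restrict false (ℓ (suc n) (2 ^ n ℕ.+ s')))
    ≡⟨ cong₂ _+_ (trans (sumCube-cong n (ℓ-true∷-upper s')) (sumCube-const n -[1+ 0 ]))
                 (trans (sumCube-cong n (ℓ-false∷-upper s')) (sum-ℓ n s' s'≤N)) ⟩
  + (2 ^ n) * -[1+ 0 ] + (+ (2 ^ n) - + 2 * + s')
    ≡⟨ identity (+ (2 ^ n)) (+ s') ⟩
  + 2 * + (2 ^ n) - + 2 * (+ (2 ^ n) + + s')
    ≡⟨ cong₂ (λ u v → u - + 2 * v) (sym (ℤ.pos-* 2 (2 ^ n))) (sym (ℤ.pos-+ (2 ^ n) s')) ⟩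
  + (2 ^ suc n) - + 2 * + (2 ^ n ℕ.+ s') ∎
  where
  open ≡-Reasoning
  identity : ∀ N s → N * -[1+ 0 ] + (N - + 2 * s) ≡ + 2 * N - + 2 * (N + s)
  identity = solve-∀

fourierWeight-difference : ∀ n (f g : Cube n → ℤ) →
  (∀ y → f y * f y ≡ + 1) → (∀ y → g y * g y ≡ + 1) →
  fourierWeight n (λ y → f y - g y) ≡
  + (2 ^ n) * (+ 2 * + (2 ^ n) - + 2 * sumCube n (λ y → f y * g y))
fourierWeight-difference n f g f²≡1 g²≡1 = begin
  fourierWeight n (λ y → f y - g y)
    ≡⟨ parseval n (λ y → f y - g y) ⟩
  + (2 ^ n) * sumCube n (λ y → (f y - g y) * (f y - g y))
    ≡⟨ cong (+ (2 ^ n) *_) (sumCube-cong n pointwise) ⟩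
  + (2 ^ n) * sumCube n (λ y → + 2 * + 1 + -[1+ 1 ] * (f y * g y))
    ≡⟨ cong (+ (2 ^ n) *_) (trans (sumCube-linear n (+ 2) -[1+ 1 ] (λ _ → + 1) fg)
                                  (cong (λ u → + 2 * u + -[1+ 1 ] * sumCube n fg) (sumCube-const n (+ 1)))) ⟩
  + (2 ^ n) * (+ 2 * (+ (2 ^ n) * + 1) + -[1+ 1 ] * sumCube n (λ y → f y * g y))
    ≡⟨ identity (+ (2 ^ n)) (sumCube n fg) ⟩
  + (2 ^ n) * (+ 2 * + (2 ^ n) - + 2 * sumCube n (λ y → f y * g y)) ∎
  where
  open ≡-Reasoning
  fg = λ y → f y * g y
  expand : ∀ a b → (a - b) * (a - b) ≡ a * a + b * b + -[1+ 1 ] * (a * b)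
  expand = solve-∀
  pointwise : ∀ y → (f y - g y) * (f y - g y) ≡ + 2 * + 1 + -[1+ 1 ] * (f y * g y)
  pointwise y = trans (expand (f y) (g y))
    (cong₂ (λ u v → u + v + -[1+ 1 ] * (f y * g y)) (f²≡1 y) (g²≡1 y))
  identity : ∀ N x → N * (+ 2 * (N * + 1) + -[1+ 1 ] * x) ≡ N * (+ 2 * N - + 2 * x)
  identity = solve-∀

ℓ-influence : ℕ → ℕ → ℤ
ℓ-influence n s = scaledInfluence n (ℓ n s)

ℓ-influence-lower : ∀ n s → s ℕ.≤ 2 ^ n →
  ℓ-influence (suc n) s ≡ + 2 * ℓ-influence n s + + 4 * (+ (2 ^ n) * + s)
ℓ-influence-lower n s s≤N = begin
  ℓ-influence (suc n) s
    ≡⟨ scaledInfluence-suc n (ℓ (suc n) s) ⟩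
  + 2 * ℓ-influence n s + + 2 * scaledInfluence n h + fourierWeight n (λ y → h y - ℓ n s y)
    ≡⟨ cong₂ (λ u v → + 2 * ℓ-influence n s + + 2 * u + v)
         (trans (scaledInfluence-cong n (ℓ-false∷-lower s≤N)) (scaledInfluence-const n (+ 1)))
         (trans (fourierWeight-cong n (λ y → cong (_- ℓ n s y) (ℓ-false∷-lower s≤N y)))
                (fourierWeight-difference n (λ _ → + 1) (ℓ n s) (λ _ → refl) (ℓ²≡1 n s))) ⟩
  + 2 * ℓ-influence n s + + 2 * + 0
    + + (2 ^ n) * (+ 2 * + (2 ^ n) - + 2 * sumCube n (λ y → + 1 * ℓ n s y))
    ≡⟨ cong (λ u → + 2 * ℓ-influence n s + + 2 * + 0 + + (2 ^ n) * (+ 2 * + (2 ^ n) - + 2 * u))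
         (trans (sumCube-cong n (λ y → ℤ.*-identityˡ (ℓ n s y))) (sum-ℓ n s s≤N)) ⟩
  + 2 * ℓ-influence n s + + 2 * + 0
    + + (2 ^ n) * (+ 2 * + (2 ^ n) - + 2 * (+ (2 ^ n) - + 2 * + s))
    ≡⟨ identity (ℓ-influence n s) (+ (2 ^ n)) (+ s) ⟩
  + 2 * ℓ-influence n s + + 4 * (+ (2 ^ n) * + s) ∎
  where
  open ≡-Reasoning
  h = restrict false (ℓ (suc n) s)
  identity : ∀ q N s → + 2 * q + + 2 * + 0 + N * (+ 2 * N - + 2 * (N - + 2 * s))
                       ≡ + 2 * q + + 4 * (N * s)
  identity = solve-∀

ℓ-influence-upper : ∀ n s → s ℕ.≤ 2 ^ n →
  ℓ-influence (suc n) (2 ^ n ℕ.+ s) ≡ + 2 * ℓ-influence n s + + 4 * (+ (2 ^ n) * (+ (2 ^ n) - + s))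
ℓ-influence-upper n s s≤N = begin
  ℓ-influence (suc n) (2 ^ n ℕ.+ s)
    ≡⟨ scaledInfluence-suc n (ℓ (suc n) (2 ^ n ℕ.+ s)) ⟩
  + 2 * scaledInfluence n g + + 2 * scaledInfluence n h + fourierWeight n (λ y → h y - g y)
    ≡⟨ cong₂ _+_
         (cong₂ (λ u v → + 2 * u + + 2 * v)
           (trans (scaledInfluence-cong n (ℓ-true∷-upper s)) (scaledInfluence-const n -[1+ 0 ]))
           (scaledInfluence-cong n (ℓ-false∷-upper s)))
         (trans (fourierWeight-cong n (λ y → cong₂ _-_ (ℓ-false∷-upper s y) (ℓ-true∷-upper s y)))
                (fourierWeight-difference n (ℓ n s) (λ _ → -[1+ 0 ]) (ℓ²≡1 n s) (λ _ → refl))) ⟩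
  + 2 * + 0 + + 2 * ℓ-influence n s
    + + (2 ^ n) * (+ 2 * + (2 ^ n) - + 2 * sumCube n (λ y → ℓ n s y * -[1+ 0 ]))
    ≡⟨ cong (λ u → + 2 * + 0 + + 2 * ℓ-influence n s + + (2 ^ n) * (+ 2 * + (2 ^ n) - + 2 * u))
         (trans (sumCube-cong n (λ y → ℤ.*-comm (ℓ n s y) -[1+ 0 ]))
         (trans (sumCube-*ˡ n -[1+ 0 ] (ℓ n s)) (cong (-[1+ 0 ] *_) (sum-ℓ n s s≤N)))) ⟩
  + 2 * + 0 + + 2 * ℓ-influence n s
    + + (2 ^ n) * (+ 2 * + (2 ^ n) - + 2 * (-[1+ 0 ] * (+ (2 ^ n) - + 2 * + s)))
    ≡⟨ identity (ℓ-influence n s) (+ (2 ^ n)) (+ s) ⟩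
  + 2 * ℓ-influence n s + + 4 * (+ (2 ^ n) * (+ (2 ^ n) - + s)) ∎
  where
  open ≡-Reasoning
  g = restrict true (ℓ (suc n) (2 ^ n ℕ.+ s))
  h = restrict false (ℓ (suc n) (2 ^ n ℕ.+ s))
  identity : ∀ q N s → + 2 * + 0 + + 2 * q + N * (+ 2 * N - + 2 * (-[1+ 0 ] * (N - + 2 * s)))
                       ≡ + 2 * q + + 4 * (N * (N - s))
  identity = solve-∀

-- Composing two halving steps: the first contributes 4·(2N)·a, the second 8N·b, and in
-- each of the four cases a + b = 2t for some t ≤ N.
compose-steps : ∀ q₀ N a b t {q₂ q₁ M : ℤ} → M ≡ + 2 * N →
  q₂ ≡ + 2 * q₁ + + 4 * (M * a) → q₁ ≡ + 2 * q₀ + + 4 * (N * b) → a + b ≡ + 2 * t →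
  q₂ ≡ + 4 * q₀ + + 16 * (N * t)
compose-steps q₀ N a b t refl refl refl a+b≡2t = begin
  + 2 * (+ 2 * q₀ + + 4 * (N * b)) + + 4 * ((+ 2 * N) * a)
    ≡⟨ expand q₀ N a b ⟩
  + 4 * q₀ + + 8 * (N * (a + b))
    ≡⟨ cong (λ z → + 4 * q₀ + + 8 * (N * z)) a+b≡2t ⟩
  + 4 * q₀ + + 8 * (N * (+ 2 * t))
    ≡⟨ collect q₀ N t ⟩
  + 4 * q₀ + + 16 * (N * t) ∎
  where
  open ≡-Reasoning
  expand : ∀ q N a b → + 2 * (+ 2 * q + + 4 * (N * b)) + + 4 * ((+ 2 * N) * a)
                       ≡ + 4 * q + + 8 * (N * (a + b))
  expand = solve-∀
  collect : ∀ q N t → + 4 * q + + 8 * (N * (+ 2 * t)) ≡ + 4 * q + + 16 * (N * t)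
  collect = solve-∀

pos-2^suc : ∀ n → + (2 ^ suc n) ≡ + 2 * + (2 ^ n)
pos-2^suc n = ℤ.pos-* 2 (2 ^ n)

ℓ-influence-suc-suc : ∀ n s → s ℕ.≤ 2 ^ suc (suc n) →
  ∃₂ λ r t → r ℕ.≤ 2 ^ n × t ℤ.≤ + (2 ^ n) ×
             ℓ-influence (suc (suc n)) s ≡ + 4 * ℓ-influence n r + + 16 * (+ (2 ^ n) * t)
ℓ-influence-suc-suc n s p with half (suc n) p
... | lower s≤M with half n s≤M
...   | lower s≤N = s , + s , s≤N , +≤+ s≤N ,
  compose-steps (ℓ-influence n s) (+ (2 ^ n)) (+ s) (+ s) (+ s) (pos-2^suc n)
    (ℓ-influence-lower (suc n) s s≤M) (ℓ-influence-lower n s s≤N) (twice (+ s))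
  where
  twice : ∀ s → s + s ≡ + 2 * s
  twice = solve-∀
...   | upper {s'} s'≤N = s' , + (2 ^ n) , s'≤N , ℤ.≤-refl ,
  compose-steps (ℓ-influence n s') (+ (2 ^ n)) (+ (2 ^ n ℕ.+ s')) (+ (2 ^ n) - + s') (+ (2 ^ n))
    (pos-2^suc n) (ℓ-influence-lower (suc n) _ s≤M) (ℓ-influence-upper n s' s'≤N)
    (trans (cong (_+ (+ (2 ^ n) - + s')) (ℤ.pos-+ (2 ^ n) s')) (cancel (+ (2 ^ n)) (+ s')))
  where
  cancel : ∀ N s → N + s + (N - s) ≡ + 2 * N
  cancel = solve-∀
ℓ-influence-suc-suc n s p | upper {u} u≤M with half n u≤M
...   | lower u≤N = u , + (2 ^ n) , u≤N , ℤ.≤-refl ,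
  compose-steps (ℓ-influence n u) (+ (2 ^ n)) (+ (2 ^ suc n) - + u) (+ u) (+ (2 ^ n))
    (pos-2^suc n) (ℓ-influence-upper (suc n) u u≤M) (ℓ-influence-lower n u u≤N)
    (trans (cong (λ M → M - + u + + u) (pos-2^suc n)) (cancel (+ (2 ^ n)) (+ u)))
  where
  cancel : ∀ N u → + 2 * N - u + u ≡ + 2 * N
  cancel = solve-∀
...   | upper {v} v≤N = v , + (2 ^ n) - + v , v≤N , ℤ.i-j≤i (+ (2 ^ n)) (+ v) ,
  compose-steps (ℓ-influence n v) (+ (2 ^ n)) (+ (2 ^ suc n) - + (2 ^ n ℕ.+ v))
    (+ (2 ^ n) - + v) (+ (2 ^ n) - + v) (pos-2^suc n)
    (ℓ-influence-upper (suc n) (2 ^ n ℕ.+ v) u≤M) (ℓ-influence-upper n v v≤N)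
    (trans (cong₂ (λ M w → M - w + (+ (2 ^ n) - + v)) (pos-2^suc n) (ℤ.pos-+ (2 ^ n) v))
           (cancel (+ (2 ^ n)) (+ v)))
  where
  cancel : ∀ N v → + 2 * N - (N + v) + (N - v) ≡ + 2 * (N - v)
  cancel = solve-∀

two-step-bound : ∀ N x t → + 3 * x ℤ.≤ + 4 * (N * N) → t ℤ.≤ N → + 0 ℤ.≤ N →
  + 3 * (+ 4 * x + + 16 * (N * t)) ℤ.≤ + 4 * ((+ 2 * (+ 2 * N)) * (+ 2 * (+ 2 * N)))
two-step-bound N x t 3x≤4N² t≤N 0≤N = subst₂ ℤ._≤_ (sym (lhs x N t)) (sym (rhs N))
  (ℤ.+-mono-≤ (ℤ.*-monoˡ-≤-nonNeg (+ 4) 3x≤4N²)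
              (ℤ.*-monoˡ-≤-nonNeg (+ 48) (ℤ.*-monoˡ-≤-nonNeg N ⦃ ℤ.nonNegative 0≤N ⦄ t≤N)))
  where
  lhs : ∀ x N t → + 3 * (+ 4 * x + + 16 * (N * t)) ≡ + 4 * (+ 3 * x) + + 48 * (N * t)
  lhs = solve-∀
  rhs : ∀ N → + 4 * ((+ 2 * (+ 2 * N)) * (+ 2 * (+ 2 * N))) ≡ + 4 * (+ 4 * (N * N)) + + 48 * (N * N)
  rhs = solve-∀

ℓ-influence-bound : ∀ n s → s ℕ.≤ 2 ^ n → + 3 * ℓ-influence n s ℤ.≤ + 4 * (+ (2 ^ n) * + (2 ^ n))
ℓ-influence-bound zero s _ =
  ℤ.≤-trans (ℤ.≤-reflexive (cong (+ 3 *_) (scaledInfluence-dim0 (ℓ 0 s)))) (+≤+ z≤n)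
ℓ-influence-bound (suc zero) zero                _ = toWitness {a? = _ ℤ.≤? _} tt
ℓ-influence-bound (suc zero) (suc zero)          _ = toWitness {a? = _ ℤ.≤? _} tt
ℓ-influence-bound (suc zero) (suc (suc zero))    _ = toWitness {a? = _ ℤ.≤? _} tt
ℓ-influence-bound (suc zero) (suc (suc (suc s))) (s≤s (s≤s ()))
ℓ-influence-bound (suc (suc n)) s p with ℓ-influence-suc-suc n s p
... | r , t , r≤N , t≤N , q≡ =
  subst₂ ℤ._≤_ (cong (+ 3 *_) (sym q≡)) (cong (λ M → + 4 * (M * M)) (sym 4N))
  (two-step-bound (+ (2 ^ n)) _ t (ℓ-influence-bound n r r≤N) t≤N (+≤+ z≤n))
  where
  4N : + (2 ^ suc (suc n)) ≡ + 2 * (+ 2 * + (2 ^ n))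
  4N = trans (pos-2^suc (suc n)) (cong (+ 2 *_) (pos-2^suc n))

module _ {X : Set} (a c : X → ℤ) (k : ℕ) where

  private
    term : X → ℚ
    term S = (a S / suc k) ℚ.* (a S / suc k) ℚ.* (c S / 1)

    denominator-1 : ℕ
    denominator-1 = ℕ.pred (suc k ℕ.* suc k ℕ.* 1)

  sumℚ-scaled-squares : ∀ xs →
    toℚᵘ (sumℚ (map term xs)) ℚᵘ.≃ mkℚᵘ (sumℤ (map (λ S → a S * a S * c S) xs)) denominator-1
  sumℚ-scaled-squares []       = *≡* refl
  sumℚ-scaled-squares (S ∷ xs) = ℚᵘ.≃-trans (ℚ.toℚᵘ-homo-+ (term S) (sumℚ (map term xs)))
    (ℚᵘ.≃-trans (ℚᵘ.+-cong term≃ (sumℚ-scaled-squares xs))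
      (common-denominator (a S * a S * c S) (sumℤ (map (λ S → a S * a S * c S) xs)) denominator-1))
    where
    common-denominator : ∀ x y m → (mkℚᵘ x m ℚᵘ.+ mkℚᵘ y m) ℚᵘ.≃ mkℚᵘ (x + y) m
    common-denominator x y m =
      *≡* (trans (identity x y (+ suc m)) (cong ((x + y) *_) (ℤ.pos-* (suc m) (suc m))))
      where
      identity : ∀ x y E → (x * E + y * E) * E ≡ (x + y) * (E * E)
      identity = solve-∀
    term≃ : toℚᵘ (term S) ℚᵘ.≃ mkℚᵘ (a S * a S * c S) denominator-1
    term≃ = ℚᵘ.≃-trans (ℚ.toℚᵘ-homo-* ((a S / suc k) ℚ.* (a S / suc k)) (c S / 1))
      (ℚᵘ.*-cong (ℚᵘ.≃-trans (ℚ.toℚᵘ-homo-* (a S / suc k) (a S / suc k))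
                   (ℚᵘ.*-cong (ℚ.toℚᵘ-fromℚᵘ (mkℚᵘ (a S) k)) (ℚ.toℚᵘ-fromℚᵘ (mkℚᵘ (a S) k))))
                 (ℚ.toℚᵘ-fromℚᵘ (mkℚᵘ (c S) 0)))

sumℚ-scaled-squares-≤-4/3 : ∀ {X : Set} (a c : X → ℤ) d .{{_ : ℕ.NonZero d}} (xs : List X) →
  + 3 * sumℤ (map (λ S → a S * a S * c S) xs) ℤ.≤ + 4 * (+ d * + d) →
  sumℚ (map (λ S → (a S / d) ℚ.* (a S / d) ℚ.* (c S / 1)) xs) ℚ.≤ + 4 / 3
sumℚ-scaled-squares-≤-4/3 a c (suc k) xs 3Σ≤4d² = ℚ.toℚᵘ-cancel-≤
  (ℚᵘ.≤-respˡ-≃ (ℚᵘ.≃-sym (sumℚ-scaled-squares a c k xs))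
    (*≤* (subst₂ ℤ._≤_ (ℤ.*-comm (+ 3) _) d²≡ 3Σ≤4d²)))
  where
  d²≡ : + 4 * (+ suc k * + suc k) ≡ + 4 * + (suc k ℕ.* suc k ℕ.* 1)
  d²≡ = cong (+ 4 *_) (trans (sym (ℤ.pos-* (suc k) (suc k))) (cong +_ (sym (ℕ.*-identityʳ _))))

influence-ℓ≤4/3 : ∀ n s → s ℕ.≤ 2 ^ n → influence n (ℓ n s) ℚ.≤ + 4 / 3
influence-ℓ≤4/3 n s s≤N = sumℚ-scaled-squares-≤-4/3 (scaledFourier n (ℓ n s)) (λ S → + card S)
  (2 ^ n) {{ℕ.m^n≢0 2 n}} (allCube n) (ℓ-influence-bound n s s≤N)

floorScaled<2^n : ∀ d c n → floorScaled (digits d c) n ℕ.< 2 ^ n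
floorScaled<2^n d c zero    = s≤s z≤n
floorScaled<2^n d c (suc n) = ℕ.≤-trans (s≤s (ℕ.+-monoʳ-≤ (2 ℕ.* f) (digit≤1 (d n))))
  (ℕ.≤-trans (ℕ.≤-reflexive (identity f)) (ℕ.*-monoʳ-≤ 2 (floorScaled<2^n d c n)))
  where
  f = floorScaled (digits d c) n
  digit≤1 : ∀ b → digit b ℕ.≤ 1
  digit≤1 true  = s≤s z≤n
  digit≤1 false = z≤n
  identity : ∀ f → suc (2 ℕ.* f ℕ.+ 1) ≡ 2 ℕ.* suc f
  identity f = trans (cong suc (ℕ.+-comm (2 ℕ.* f) 1)) (sym (ℕ.*-suc 2 f))

floorScaled≤2^n : ∀ μ n → floorScaled μ n ℕ.≤ 2 ^ n
floorScaled≤2^n one            n = ℕ.≤-refl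
floorScaled≤2^n (digits d c) n = ℕ.<⇒≤ (floorScaled<2^n d c n)

p≤p+ε : ∀ p ε → Positive ε → p ℚ.≤ p ℚ.+ ε
p≤p+ε p ε ε>0 = subst (ℚ._≤ p ℚ.+ ε) (ℚ.+-identityʳ p)
  (ℚ.+-monoʳ-≤ p (ℚ.nonNegative⁻¹ ε {{ℚ.pos⇒nonNeg ε {{ε>0}}}}))

claim10 : (μ : UnitReal) → (ε : ℚ) → Positive ε →
    ∃ λ M → (n : ℕ) → n ≥ M → influence n (ℓμ μ n) ℚ.≤ (+ 4 / 3) ℚ.+ ε
claim10 μ ε ε>0 = 0 , λ n _ →
  ℚ.≤-trans (influence-ℓ≤4/3 n (floorScaled μ n) (floorScaled≤2^n μ n)) (p≤p+ε (+ 4 / 3) ε ε>0)
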